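{- Let $i$ be an IR-MIA that is strong may-input-enabled, and let $i'$ be an IR-MIA with $i'\sqsubseteq_\Phi i$. Then $i'$ is strong may-input-enabled.
   Context: An IR-MIA (Modal Interface Automaton with Input Refusals) is a tuple $(Q,I,O,\longrightarrow_\Box,\longrightarrow_\Diamond,q_\Phi)$ with a designated initial state (the IR-MIA is identified with its initial state), where $Q$ is a finite set of states containing a failure state $q_\Phi$, $I$ and $O$ are disjoint finite sets of input and output actions, $\tau\notin I\cup O$ is the internal action, and the must-relation $\longrightarrow_\Box$ and the may-relation $\longrightarrow_\Diamond$ are subsets of $((Q\setminus\{q_\Phi\})\times I\times Q)\cup((Q\setminus\{q_\Phi\})\times(O\cup\{\tau\})\times(Q\setminus\{q_\Phi\}))$ such that for all $a\in I\cup O\cup\{\tau\}$ and $i\in I$: $q\xrightarrow{a}_\Box q'$ implies $q\xrightarrow{a}_\Diamond q'$; $q\xrightarrow{i}_\Diamond q_\Phi$ iff $q\xrightarrow{i}_\Box q_\Phi$; and if $q\xrightarrow{i}_\Box q_\Phi$ then every $q'$ with $q\xrightarrow{i}_\Diamond q'$ equals $q_\Phi$. For $\gamma\in\{\Box,\Diamond\}$ write $q\xrightarrow{a}_\gamma$ if $q\xrightarrow{a}_\gamma q'$ for some $q'$, and $q\not\xrightarrow{a}_\gamma$ otherwise. $q\overset{\epsilon}{\Longrightarrow}_\gamma q'$ means $q=q'$ or $q'$ is reached from $q$ by finitely many $\tau$-transitions of $\longrightarrow_\gamma$; $q\overset{a}{\Longrightarrow}_\gamma q'$ means $q\overset{\epsilon}{\Longrightarrow}_\gamma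 q_1\xrightarrow{a}_\gamma q_2\overset{\epsilon}{\Longrightarrow}_\gamma q'$ for some $q_1,q_2$; $q\xrightarrow{i}_\gamma\overset{\epsilon}{\Longrightarrow}_\gamma q'$ means one $i$-step followed by finitely many $\tau$-steps, all in $\longrightarrow_\gamma$. For $\omega\in O\cup\{\tau\}$, $q\overset{\hat\omega}{\Longrightarrow}_\gamma q'$ means $q\overset{\omega}{\Longrightarrow}_\gamma q'$ if $\omega\in O$ and $q\overset{\epsilon}{\Longrightarrow}_\gamma q'$ if $\omega=\tau$. Refinement: for IR-MIA $P,Q$ with the same input set $I$ and output set $O$ (failure states $p_\Phi,q_\Phi$), a relation $\mathcal R\subseteq P\times Q$ is an IR-MIA refinement relation if for all $(p,q)\in\mathcal R$ with $p\neq p_\Phi$, all $i\in I$ and all $\omega\in O\cup\{\tau\}$: (1) $q\neq q_\Phi$; (2) if $q\xrightarrow{i}_\Box q'\neq q_\Phi$ then there is $p'\neq p_\Phi$ with $p\xrightarrow{i}_\Box\overset{\epsilon}{\Longrightarrow}_\Box p'$ and $(p',q')\in\mathcal R$; (3) if $q\xrightarrow{\omega}_\Box q'$ then there is $p'$ with $p\overset{\hat\omega}{\Longrightarrow}_\Box p'$ and $(p',q')\in\mathcal R$; (4) if $p\xrightarrow{i}_\Diamond p'$ and $q\xrightarrow{i}_\Diamond$ then there is $q'$ with $q\xrightarrow{i}_\Diamond\overset{\epsilon}{\Longrightarrow}_\Diamond q'$ and $(p',q')\in\mathcal R$; (5) if $q\xrightarrow{i}_\Diamond q'$ then there is $p'$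 with $p\xrightarrow{i}_\Diamond\overset{\epsilon}{\Longrightarrow}_\Diamond p'$ and $(p',q')\in\mathcal R$; (6) if $p\xrightarrow{\omega}_\Diamond p'$ then there is $q'$ with $q\overset{\hat\omega}{\Longrightarrow}_\Diamond q'$ and $(p',q')\in\mathcal R$. $P\sqsubseteq_\Phi Q$ means the initial states are related by some such $\mathcal R$. An IR-MIA is strong may-input-enabled if for every state $q\neq q_\Phi$ and every $i\in I$ there is $q'$ with $q\xrightarrow{i}_\Diamond q'$. -}

module Defs where

open import Data.Nat using (ℕ)
open import Data.Fin using (Fin)
open import Data.Product using (Σ; ∃; _×_; _,_)
open import Data.Sum using (_⊎_; inj₁; inj₂)
open import Relation.Binary.PropositionalEquality using (_≡_; _≢_)
open import Relation.Binary.Construct.Closure.ReflexiveTransitive using (Star)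

data Act (nI nO : ℕ) : Set where
  inp : Fin nI → Act nI nO
  out : Fin nO → Act nI nO
  τ   : Act nI nO

data OutTau (nO : ℕ) : Set where
  out : Fin nO → OutTau nO
  τ   : OutTau nO

toAct : ∀ {nI nO} → OutTau nO → Act nI nO
toAct (out o) = out o
toAct τ       = τ

record IRMIA (nI nO : ℕ) : Set₁ where
  field
    nQ   : ℕ
    qΦ   : Fin nQ
    init : Fin nQ
    must : Fin nQ → Act nI nO → Fin nQ → Set
    may  : Fin nQ → Act nI nO → Fin nQ → Set
    must-src : ∀ {q a q'} → must q a q' → q ≢ qΦ
    may-src  : ∀ {q a q'} → may  q a q' → q ≢ qΦ
    must-tgt : ∀ {q ω q'} → must q (toAct ω) q' → q' ≢ qΦ
    may-tgt  : ∀ {q ω q'} → may  q (toAct ω) q' → q' ≢ qΦ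
    must⇒may : ∀ {q a q'} → must q a q' → may q a q'
    mayΦ⇒mustΦ : ∀ {q i} → may q (inp i) qΦ → must q (inp i) qΦ
    mustΦ-only : ∀ {q i q'} → must q (inp i) qΦ → may q (inp i) q' → q' ≡ qΦ
    -- convention: every state is reachable from the initial state via
    -- may-transitions (an IR-MIA is identified with its initial state, so
    -- states unreachable from it are not part of the automaton), except
    -- possibly the failure state qΦ
    reachable : ∀ q → q ≢ qΦ → Star (λ x y → ∃ λ a → may x a y) init q

module _ {nI nO : ℕ} (M : IRMIA nI nO) where
  open IRMIA M

  Q : Set
  Q = Fin nQ

  _-[_]→□ : Q → Act nI nO → Set
  q -[ a ]→□ = ∃ λ q' → must q a q'

  _-[_]→◇ : Q → Act nI nO → Set
  q -[ a ]→◇ = ∃ λ q' → may q a q'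

  ⇒ε□ : Q → Q → Set
  ⇒ε□ = Star (λ q q' → must q τ q')

  ⇒ε◇ : Q → Q → Set
  ⇒ε◇ = Star (λ q q' → may q τ q')

  ⇒□ : Act nI nO → Q → Q → Set
  ⇒□ a q q' = ∃ λ q₁ → ∃ λ q₂ → ⇒ε□ q q₁ × must q₁ a q₂ × ⇒ε□ q₂ q'

  ⇒◇ : Act nI nO → Q → Q → Set
  ⇒◇ a q q' = ∃ λ q₁ → ∃ λ q₂ → ⇒ε◇ q q₁ × may q₁ a q₂ × ⇒ε◇ q₂ q'

  i⇒□ : Fin nI → Q → Q → Set
  i⇒□ i q q' = ∃ λ q₂ → must q (inp i) q₂ × ⇒ε□ q₂ q'

  i⇒◇ : Fin nI → Q → Q → Set
  i⇒◇ i q q' = ∃ λ q₂ → may q (inp i) q₂ × ⇒ε◇ q₂ q'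

  hat□ : OutTau nO → Q → Q → Set
  hat□ (out o) = ⇒□ (out o)
  hat□ τ       = ⇒ε□

  hat◇ : OutTau nO → Q → Q → Set
  hat◇ (out o) = ⇒◇ (out o)
  hat◇ τ       = ⇒ε◇

record IsRefinement {nI nO : ℕ} (P Q : IRMIA nI nO)
    (R : Fin (IRMIA.nQ P) → Fin (IRMIA.nQ Q) → Set) : Set where
  module P = IRMIA P
  module Q = IRMIA Q
  field
    r1 : ∀ {p q} → R p q → p ≢ P.qΦ → q ≢ Q.qΦ
    r2 : ∀ {p q} → R p q → p ≢ P.qΦ → ∀ i {q'} → Q.must q (inp i) q' → q' ≢ Q.qΦ →
           ∃ λ p' → p' ≢ P.qΦ × i⇒□ P i p p' × R p' q'
    r3 : ∀ {p q} → R p q → p ≢ P.qΦ → ∀ ω {q'} → Q.must q (toAct ω) q' →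
           ∃ λ p' → hat□ P ω p p' × R p' q'
    r4 : ∀ {p q} → R p q → p ≢ P.qΦ → ∀ i {p'} → P.may p (inp i) p' →
           _-[_]→◇ Q q (inp i) →
           ∃ λ q' → i⇒◇ Q i q q' × R p' q'
    r5 : ∀ {p q} → R p q → p ≢ P.qΦ → ∀ i {q'} → Q.may q (inp i) q' →
           ∃ λ p' → i⇒◇ P i p p' × R p' q'
    r6 : ∀ {p q} → R p q → p ≢ P.qΦ → ∀ ω {p'} → P.may p (toAct ω) p' →
           ∃ λ q' → hat◇ Q ω q q' × R p' q'

_⊑Φ_ : ∀ {nI nO} → IRMIA nI nO → IRMIA nI nO → Set₁
P ⊑Φ Q = ∃ λ (R : Fin (IRMIA.nQ P) → Fin (IRMIA.nQ Q) → Set) →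
           IsRefinement P Q R × R (IRMIA.init P) (IRMIA.init Q)

StrongMayInputEnabled : ∀ {nI nO} → IRMIA nI nO → Set
StrongMayInputEnabled M =
  ∀ (q : Fin (IRMIA.nQ M)) → q ≢ IRMIA.qΦ M → ∀ i → ∃ λ q' → IRMIA.may M q (inp i) q'

module Submission where

-- Every non-failure state p of i' is reachable from the initial state along
-- may-transitions, and the refinement relation can be propagated along such a
-- path (clauses (4) and (6); clause (4) applies because i is may-input-enabled),
-- so p is related to some state q of i. By clause (1) q is not the failure
-- state, so q has a may-i-transition, which clause (5) pulls back to p.

open import Defs
open import Data.Nat using (ℕ)
open import Data.Fin using (Fin)
open import Data.Product using (∃; _,_)
open import Relation.Binary.Construct.Closure.ReflexiveTransitive using (Star; ε; _◅_)

module _ {nI nO : ℕ} {P Q : IRMIA nI nO} (Q-enabled : StrongMayInputEnabled Q)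
         {R : Fin (IRMIA.nQ P) → Fin (IRMIA.nQ Q) → Set} (isR : IsRefinement P Q R) where
  open IsRefinement isR

  related-may-step : ∀ {p p' q} a → R p q → P.may p a p' → ∃ λ q' → R p' q'
  related-may-step (inp j) r m
    with _ , _ , r' ← r4 r (P.may-src m) j m (Q-enabled _ (r1 r (P.may-src m)) j) = _ , r'
  related-may-step (out o) r m with _ , _ , r' ← r6 r (P.may-src m) (out o) m = _ , r'
  related-may-step τ       r m with _ , _ , r' ← r6 r (P.may-src m) τ m       = _ , r'

  related-may-path : ∀ {p p' q} → R p q → Star (λ x y → ∃ λ a → P.may x a y) p p' →
                     ∃ λ q' → R p' q'
  related-may-path r ε = _ , r
  related-may-path r ((a , m) ◅ path) with _ , r' ← related-may-step a r m =
    related-may-path r' path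

lemma1 : ∀ {nI nO : ℕ} (i i' : IRMIA nI nO) →
    StrongMayInputEnabled i → i' ⊑Φ i → StrongMayInputEnabled i'
lemma1 i i' i-enabled (R , isR , r-init) p p≢Φ j
  with q , r ← related-may-path i-enabled isR r-init (IRMIA.reachable i' p p≢Φ)
  with _ , m ← i-enabled q (IsRefinement.r1 isR r p≢Φ) j
  with _ , (p' , m' , _) , _ ← IsRefinement.r5 isR r p≢Φ j m
  = p' , m'
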